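{- For every integer $m>3$, \[ \frac{m+1}{5}+\frac{4F_{m+1}}{5L_{m+1}} -\frac{F_{m-3}(F_{m+2}+F_{m-2})}{F_{2m+2}} = \frac{(F_{2m-2}+3F_{m-2}^2)(4F_{2m-2}+3F^2_{m-1})}{3F_{2m-2}F_{2m+2}}+\frac{1}{3}+\sum_{i=1}^{m-2}\frac{F_iF_{i+1}}{L_iL_{i+1}}. \]
   Context: $F_p$ denotes the $p$th Fibonacci number ($F_0=0$, $F_1=1$, $F_{p+1}=F_p+F_{p-1}$) and $L_q$ the $q$th Lucas number ($L_0=2$, $L_1=1$, $L_{q+1}=L_q+L_{q-1}$). -}

module Defs where

open import Data.Nat using (ℕ; zero; suc; _+_; _*_)
open import Data.Integer using (+_)
open import Data.Rational using (ℚ; _/_; 0ℚ)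
import Data.Rational as Q

F : ℕ → ℕ
F zero = 0
F (suc zero) = 1
F (suc (suc p)) = F (suc p) + F p

L : ℕ → ℕ
L zero = 2
L (suc zero) = 1
L (suc (suc q)) = L (suc q) + L q

-- Convention a/0 := 0; it is only
-- ever applied below to denominators that are positive (F_{2m±2} with m > 3,
-- L_i ≥ 1, and the constants 3, 5, 15), so the convention is never used.
frac : ℕ → ℕ → ℚ
frac a zero = 0ℚ
frac a (suc d) = (+ a) / suc d

sumFrom1 : ℕ → (ℕ → ℚ) → ℚ
sumFrom1 zero f = 0ℚ
sumFrom1 (suc n) f = sumFrom1 n f Q.+ f (suc n)

module Submission where

-- Write m = n + 4.  The sum telescopes: its summand is
-- partial(i) - partial(i-1) for partial(k) = (k+1)/5 - F_{k+1}/(5 L_{k+1}),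
-- because
--   F_i F_{i+1}/(L_i L_{i+1}) + F_{i+1}/(5 L_{i+1}) = 1/5 + F_i/(5 L_i),
-- so the sum equals (m-1)/5 - F_{m-1}/(5 L_{m-1}).  Splitting
-- (m+1)/5 = 2/5 + (m-1)/5, the theorem becomes the key identity
--   2/5 + 4F_{m+1}/(5L_{m+1}) + F_{m-1}/(5L_{m-1})
--     = (F_{2m-2} + 3F_{m-2}^2)(4F_{2m-2} + 3F_{m-1}^2)/(3F_{2m-2}F_{2m+2})
--       + 1/3 + F_{m-3}(F_{m+2}+F_{m-2})/F_{2m+2}.
-- This and the summand identity are checked by cross-multiplying: the
-- resulting equation of natural numbers is a polynomial identity in F_n and
-- F_{n+1} once each L_k is written as F_{k-1} + F_{k+1} and each F_{2k} as
-- F_k L_k.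

open import Defs
open import Data.Nat using (ℕ; zero; suc; _+_; _*_; _∸_; _>_; z≤n; s≤s; NonZero; >-nonZero)
open import Data.Nat.Properties
  using (+-comm; +-identityʳ; *-comm; *-distribˡ-+; ≤-trans; m≤m+n; m*n≢0; +-commutativeSemigroup)
open import Algebra.Properties.CommutativeSemigroup +-commutativeSemigroup using (interchange)
open import Data.Nat.Tactic.RingSolver using (solve-∀; solve)
open import Data.List using (_∷_; [])
import Data.Integer as ℤ
open import Data.Integer.Properties using (pos-+; pos-*)
open import Data.Rational using (ℚ; 0ℚ; toℚᵘ; fromℚᵘ)
import Data.Rational as Q
import Data.Rational.Properties as QP
open import Data.Rational.Solver using (module +-*-Solver)
open import Data.Rational.Unnormalised using (mkℚᵘ; *≡*) renaming (_+_ to _+ᵘ_)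
import Data.Rational.Unnormalised.Properties as UP
open +-*-Solver using (_:=_; _:+_; _:-_) renaming (solve to solveℚ)
open import Function.Base using (it)
open import Relation.Binary.PropositionalEquality

F-nonZero : ∀ k → {{NonZero k}} → NonZero (F k)
F-nonZero zero {{()}}
F-nonZero (suc k) = >-nonZero (F-pos k)
  where
  F-pos : ∀ k → F (suc k) > 0
  F-pos zero    = s≤s z≤n
  F-pos (suc k) = ≤-trans (F-pos k) (m≤m+n (F (suc k)) (F k))

L-nonZero : ∀ k → NonZero (L k)
L-nonZero k = >-nonZero (L-pos k)
  where
  L-pos : ∀ k → L k > 0
  L-pos zero          = s≤s z≤n
  L-pos (suc zero)    = s≤s z≤n
  L-pos (suc (suc k)) = ≤-trans (L-pos (suc k)) (m≤m+n (L (suc k)) (L k))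

-- L_{k+1} = F_k + F_{k+2}: both sides satisfy the Fibonacci recurrence.
L≡F+F : ∀ k → L (suc k) ≡ F k + F (suc (suc k))
L≡F+F zero          = refl
L≡F+F (suc zero)    = refl
L≡F+F (suc (suc k)) =
  trans (cong₂ _+_ (L≡F+F (suc k)) (L≡F+F k))
        (interchange (F (suc k)) (F (3 + k)) (F k) (F (2 + k)))

F-add : ∀ p q → F (suc (p + q)) ≡ F (suc p) * F (suc q) + F p * F q
F-add zero          q = sym (trans (+-identityʳ (F (suc q) + 0)) (+-identityʳ (F (suc q))))
F-add (suc zero)    q = sym (cong₂ _+_ (+-identityʳ (F (suc q))) (+-identityʳ (F q)))
F-add (suc (suc p)) q =
  trans (cong₂ _+_ (F-add (suc p) q) (F-add p q))
        (recombine (F (suc p)) (F p) (F (suc q)) (F q))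
  where
  -- the two instances of the formula add up to the next one
  recombine : ∀ a b u v →
    ((a + b) * u + a * v) + (a * u + b * v) ≡ ((a + b) + a) * u + (a + b) * v
  recombine = solve-∀

F-double : ∀ k → F (k + k) ≡ F k * L k
F-double zero    = refl
F-double (suc k) = begin
  F (suc (k + suc k))                           ≡⟨ F-add k (suc k) ⟩
  F (suc k) * F (2 + k) + F k * F (suc k)       ≡⟨ cong ((F (suc k) * F (2 + k)) +_) (*-comm (F k) (F (suc k))) ⟩
  F (suc k) * F (2 + k) + F (suc k) * F k       ≡⟨ sym (*-distribˡ-+ (F (suc k)) (F (2 + k)) (F k)) ⟩
  F (suc k) * (F (2 + k) + F k)                 ≡⟨ cong (F (suc k) *_) (+-comm (F (2 + k)) (F k)) ⟩
  F (suc k) * (F k + F (2 + k))                 ≡⟨ cong (F (suc k) *_) (sym (L≡F+F k)) ⟩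
  F (suc k) * L (suc k)                         ∎
  where open ≡-Reasoning

F-double-succ : ∀ k → F (2 * k + 2) ≡ F (k + 1) * L (k + 1)
F-double-succ k = trans (cong F (index k)) (F-double (k + 1))
  where
  index : ∀ k → 2 * k + 2 ≡ (k + 1) + (k + 1)
  index = solve-∀

F-double-pred : ∀ k → F (2 * k ∸ 2) ≡ F (k ∸ 1) * L (k ∸ 1)
F-double-pred zero    = refl
F-double-pred (suc k) = trans (cong (λ j → F (j ∸ 2)) (index k)) (F-double k)
  where
  index : ∀ k → 2 * suc k ≡ 2 + (k + k)
  index = solve-∀

fromℚᵘ-homo-+ : ∀ p q → fromℚᵘ (p +ᵘ q) ≡ fromℚᵘ p Q.+ fromℚᵘ q
fromℚᵘ-homo-+ p q = QP.toℚᵘ-injective (begin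
  toℚᵘ (fromℚᵘ (p +ᵘ q))              ≈⟨ QP.toℚᵘ-fromℚᵘ (p +ᵘ q) ⟩
  p +ᵘ q                               ≈⟨ UP.+-cong (UP.≃-sym (QP.toℚᵘ-fromℚᵘ p)) (UP.≃-sym (QP.toℚᵘ-fromℚᵘ q)) ⟩
  toℚᵘ (fromℚᵘ p) +ᵘ toℚᵘ (fromℚᵘ q)  ≈⟨ UP.≃-sym (QP.toℚᵘ-homo-+ (fromℚᵘ p) (fromℚᵘ q)) ⟩
  toℚᵘ (fromℚᵘ p Q.+ fromℚᵘ q)        ∎)
  where open UP.≃-Reasoning

-- a/d + b/e = (ae + bd)/(de).  For d = suc d', frac a d is fromℚᵘ (a / d).
frac-+ : ∀ a b d e → {{NonZero d}} → {{NonZero e}} →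
         frac a d Q.+ frac b e ≡ frac (a * e + b * d) (d * e)
frac-+ a b (suc d) (suc e) = begin
  frac a (suc d) Q.+ frac b (suc e)          ≡⟨ fromℚᵘ-homo-+ (mkℚᵘ (ℤ.+ a) d) (mkℚᵘ (ℤ.+ b) e) ⟨
  fromℚᵘ (mkℚᵘ (ℤ.+ a) d +ᵘ mkℚᵘ (ℤ.+ b) e) ≡⟨ cong (λ z → fromℚᵘ (mkℚᵘ z _)) numerator ⟩
  frac (a * suc e + b * suc d) (suc d * suc e) ∎
  where
  open ≡-Reasoning
  numerator : ℤ.+ a ℤ.* ℤ.+ suc e ℤ.+ ℤ.+ b ℤ.* ℤ.+ suc d ≡ ℤ.+ (a * suc e + b * suc d)
  numerator = sym (trans (pos-+ (a * suc e) (b * suc d))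
                         (cong₂ ℤ._+_ (pos-* a (suc e)) (pos-* b (suc d))))

frac-cross : ∀ a b d e → {{NonZero d}} → {{NonZero e}} → a * e ≡ b * d → frac a d ≡ frac b e
frac-cross a b (suc d) (suc e) ae≡bd = QP.fromℚᵘ-cong {mkℚᵘ (ℤ.+ a) d} {mkℚᵘ (ℤ.+ b) e}
  (*≡* (trans (sym (pos-* a (suc e))) (trans (cong ℤ.+_ ae≡bd) (pos-* b (suc d)))))

frac-distrib : ∀ a b d → {{NonZero d}} → frac (a + b) d ≡ frac a d Q.+ frac b d
frac-distrib a b d = sym (trans (frac-+ a b d d)
  (frac-cross (a * d + b * d) (a + b) (d * d) d {{m*n≢0 d d}} (cross a b d)))
  where
  cross : ∀ a b d → (a * d + b * d) * d ≡ (a + b) * (d * d)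
  cross = solve-∀

frac-+-cross : ∀ a b d e a′ b′ d′ e′ →
  {{NonZero d}} → {{NonZero e}} → {{NonZero d′}} → {{NonZero e′}} →
  (a * e + b * d) * (d′ * e′) ≡ (a′ * e′ + b′ * d′) * (d * e) →
  frac a d Q.+ frac b e ≡ frac a′ d′ Q.+ frac b′ e′
frac-+-cross a b d e a′ b′ d′ e′ cross =
  trans (frac-+ a b d e)
  (trans (frac-cross (a * e + b * d) (a′ * e′ + b′ * d′) (d * e) (d′ * e′)
                     {{m*n≢0 d e}} {{m*n≢0 d′ e′}} cross)
         (sym (frac-+ a′ b′ d′ e′)))

frac-+₃-cross : ∀ a b c d e f a′ b′ c′ d′ e′ f′ →
  {{NonZero d}} → {{NonZero e}} → {{NonZero f}} →
  {{NonZero d′}} → {{NonZero e′}} → {{NonZero f′}} →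
  ((a * e + b * d) * f + c * (d * e)) * (d′ * e′ * f′)
    ≡ ((a′ * e′ + b′ * d′) * f′ + c′ * (d′ * e′)) * (d * e * f) →
  frac a d Q.+ frac b e Q.+ frac c f ≡ frac a′ d′ Q.+ frac b′ e′ Q.+ frac c′ f′
frac-+₃-cross a b c d e f a′ b′ c′ d′ e′ f′ cross =
  trans (cong (Q._+ frac c f) (frac-+ a b d e))
  (trans (frac-+-cross (a * e + b * d) c (d * e) f (a′ * e′ + b′ * d′) c′ (d′ * e′) f′
                       {{m*n≢0 d e}} {{it}} {{m*n≢0 d′ e′}} {{it}} cross)
         (cong (Q._+ frac c′ f′) (sym (frac-+ a′ b′ d′ e′))))

telescope : (t g : ℕ → ℚ) → (∀ k → t (suc k) ≡ g (suc k) Q.- g k) →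
            ∀ k → sumFrom1 k t ≡ g k Q.- g 0
telescope t g step zero    = sym (QP.+-inverseʳ (g 0))
telescope t g step (suc k) = begin
  sumFrom1 k t Q.+ t (suc k)               ≡⟨ cong₂ Q._+_ (telescope t g step k) (step k) ⟩
  (g k Q.- g 0) Q.+ (g (suc k) Q.- g k)    ≡⟨ cancel (g 0) (g k) (g (suc k)) ⟩
  g (suc k) Q.- g 0                        ∎
  where
  open ≡-Reasoning
  cancel : ∀ x y z → (y Q.- x) Q.+ (z Q.- y) ≡ z Q.- x
  cancel = solveℚ 3 (λ x y z → (y :- x) :+ (z :- y) := z :- x) refl

summand : ℕ → ℚ
summand i = frac (F i * F (i + 1)) (L i * L (i + 1))

partial : ℕ → ℚ
partial k = frac (suc k) 5 Q.- frac (F (suc k)) (5 * L (suc k))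

summand-identity : ∀ k →
  frac (F (suc k) * F (2 + k)) (L (suc k) * L (2 + k)) Q.+ frac (F (2 + k)) (5 * L (2 + k))
    ≡ frac 1 5 Q.+ frac (F (suc k)) (5 * L (suc k))
summand-identity k =
  frac-+-cross (F (suc k) * F (2 + k)) (F (2 + k)) (L (suc k) * L (2 + k)) (5 * L (2 + k))
               1 (F (suc k)) 5 (5 * L (suc k))
    (polynomial (F k) (F (suc k)) (L (suc k)) (L (2 + k)) (L≡F+F k) (L≡F+F (suc k)))
  where
  instance
    L₁L₂≢0 : NonZero (L (suc k) * L (2 + k))
    L₁L₂≢0 = m*n≢0 (L (suc k)) (L (2 + k)) {{L-nonZero (suc k)}} {{L-nonZero (2 + k)}}
    5L₁≢0 : NonZero (5 * L (suc k))
    5L₁≢0 = m*n≢0 5 (L (suc k)) {{it}} {{L-nonZero (suc k)}}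
    5L₂≢0 : NonZero (5 * L (2 + k))
    5L₂≢0 = m*n≢0 5 (L (2 + k)) {{it}} {{L-nonZero (2 + k)}}
  polynomial : ∀ f₀ f₁ l₁ l₂ →
    let f₂ = f₁ + f₀ ; f₃ = f₂ + f₁ in l₁ ≡ f₀ + f₂ → l₂ ≡ f₁ + f₃ →
    (f₁ * f₂ * (5 * l₂) + f₂ * (l₁ * l₂)) * (5 * (5 * l₁))
      ≡ (1 * (5 * l₁) + f₁ * 5) * (l₁ * l₂ * (5 * l₂))
  polynomial f₀ f₁ _ _ refl refl = solve (f₀ ∷ f₁ ∷ [])

summand-step : ∀ k → summand (suc k) ≡ partial (suc k) Q.- partial k
summand-step k = begin
  summand (suc k)                       ≡⟨ cong (λ j → frac (F (suc k) * F j) (L (suc k) * L j)) (+-comm (suc k) 1) ⟩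
  t                                     ≡⟨ add-sub t u₂ ⟩
  (t Q.+ u₂) Q.- u₂                     ≡⟨ cong (Q._- u₂) (summand-identity k) ⟩
  (frac 1 5 Q.+ u₁) Q.- u₂              ≡⟨ regroup (frac 1 5) (frac (suc k) 5) u₁ u₂ ⟩
  (frac 1 5 Q.+ frac (suc k) 5 Q.- u₂) Q.- (frac (suc k) 5 Q.- u₁)
                                        ≡⟨ cong (λ x → (x Q.- u₂) Q.- partial k) (frac-distrib 1 (suc k) 5) ⟨
  partial (suc k) Q.- partial k         ∎
  where
  open ≡-Reasoning
  t u₁ u₂ : ℚ
  t  = frac (F (suc k) * F (2 + k)) (L (suc k) * L (2 + k))
  u₁ = frac (F (suc k)) (5 * L (suc k))
  u₂ = frac (F (2 + k)) (5 * L (2 + k))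
  add-sub : ∀ x y → x ≡ (x Q.+ y) Q.- y
  add-sub = solveℚ 2 (λ x y → x := (x :+ y) :- y) refl
  regroup : ∀ h s x y → (h Q.+ x) Q.- y ≡ (h Q.+ s Q.- y) Q.- (s Q.- x)
  regroup = solveℚ 4 (λ h s x y → (h :+ x) :- y := (h :+ s :- y) :- (s :- x)) refl

summand-sum : ∀ k → sumFrom1 k summand ≡ partial k
summand-sum k = begin
  sumFrom1 k summand          ≡⟨ telescope summand partial summand-step k ⟩
  partial k Q.- partial 0     ≡⟨ cong (λ x → partial k Q.- x) (QP.+-inverseʳ (frac 1 5)) ⟩
  partial k Q.+ 0ℚ            ≡⟨ QP.+-identityʳ (partial k) ⟩
  partial k                   ∎
  where open ≡-Reasoning

-- Throughout, m = n + 4, so that every index m ∸ j is a numeral plus n; the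
-- abbreviations below are literally the terms of the theorem at this m.
module AtIndex (n : ℕ) where

  m : ℕ
  m = 4 + n

  D-num D-den : ℕ
  D-num = (F (2 * m ∸ 2) + 3 * (F (m ∸ 2) * F (m ∸ 2))) * (4 * F (2 * m ∸ 2) + 3 * (F (m ∸ 1) * F (m ∸ 1)))
  D-den = 3 * F (2 * m ∸ 2) * F (2 * m + 2)

  B C D E G : ℚ
  B = frac (4 * F (m + 1)) (5 * L (m + 1))
  C = frac (F (m ∸ 3) * (F (m + 2) + F (m ∸ 2))) (F (2 * m + 2))
  D = frac D-num D-den
  E = frac (m ∸ 1) 5
  G = frac (F (m ∸ 1)) (5 * L (m ∸ 1))

  instance
    5L[m+1]≢0 : NonZero (5 * L (m + 1))
    5L[m+1]≢0 = m*n≢0 5 (L (m + 1)) {{it}} {{L-nonZero (m + 1)}}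
    5L[m-1]≢0 : NonZero (5 * L (m ∸ 1))
    5L[m-1]≢0 = m*n≢0 5 (L (m ∸ 1)) {{it}} {{L-nonZero (m ∸ 1)}}
    F[2m+2]≢0 : NonZero (F (2 * m + 2))
    F[2m+2]≢0 = F-nonZero (2 * m + 2)
    D-den≢0 : NonZero D-den
    D-den≢0 = m*n≢0 (3 * F (2 * m ∸ 2)) (F (2 * m + 2))
                {{m*n≢0 3 (F (2 * m ∸ 2)) {{it}} {{F-nonZero (2 * m ∸ 2)}}}}

  key-identity : frac 2 5 Q.+ B Q.+ G ≡ D Q.+ frac 1 3 Q.+ C
  key-identity =
    frac-+₃-cross 2 (4 * F (m + 1)) (F (m ∸ 1)) 5 (5 * L (m + 1)) (5 * L (m ∸ 1))
                  D-num 1 (F (m ∸ 3) * (F (m + 2) + F (m ∸ 2))) D-den 3 (F (2 * m + 2))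
      (polynomial (F n) (F (1 + n)) (F (m + 1)) (F (m + 2)) (L (m ∸ 1)) (L (m + 1))
                  (F (2 * m ∸ 2)) (F (2 * m + 2))
                  (cong F (+-comm m 1)) (cong F (+-comm m 2))
                  (L≡F+F (2 + n)) (trans (cong L (+-comm m 1)) (L≡F+F (4 + n)))
                  (F-double-pred m) (F-double-succ m))
    where
    polynomial : ∀ f₀ f₁ f₅′ f₆′ l₃ l₅ p₃ p₅ →
      let f₂ = f₁ + f₀ ; f₃ = f₂ + f₁ ; f₄ = f₃ + f₂ ; f₅ = f₄ + f₃ ; f₆ = f₅ + f₄ in
      f₅′ ≡ f₅ → f₆′ ≡ f₆ → l₃ ≡ f₂ + f₄ → l₅ ≡ f₄ + f₆ → p₃ ≡ f₃ * l₃ → p₅ ≡ f₅′ * l₅ →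
      let a = 2 ; b = 4 * f₅′ ; c = f₃ ; d = 5 ; e = 5 * l₅ ; f = 5 * l₃
          a′ = (p₃ + 3 * (f₂ * f₂)) * (4 * p₃ + 3 * (f₃ * f₃)) ; b′ = 1 ; c′ = f₁ * (f₆′ + f₂)
          d′ = 3 * p₃ * p₅ ; e′ = 3 ; f′ = p₅ in
      ((a * e + b * d) * f + c * (d * e)) * (d′ * e′ * f′)
        ≡ ((a′ * e′ + b′ * d′) * f′ + c′ * (d′ * e′)) * (d * e * f)
    polynomial f₀ f₁ _ _ _ _ _ _ refl refl refl refl refl refl = solve (f₀ ∷ f₁ ∷ [])

  identity : (frac (m + 1) 5 Q.+ B) Q.- C ≡ D Q.+ frac 1 3 Q.+ sumFrom1 (m ∸ 2) summand
  identity = begin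
    (frac (m + 1) 5 Q.+ B) Q.- C                  ≡⟨ cong (λ x → (x Q.+ B) Q.- C) split ⟩
    (frac 2 5 Q.+ E Q.+ B) Q.- C                  ≡⟨ regroup (frac 2 5) E B C G ⟩
    (frac 2 5 Q.+ B Q.+ G) Q.+ (E Q.- G) Q.- C    ≡⟨ cong (λ x → x Q.+ (E Q.- G) Q.- C) key-identity ⟩
    (D Q.+ frac 1 3 Q.+ C) Q.+ (E Q.- G) Q.- C    ≡⟨ cancel (D Q.+ frac 1 3) C (E Q.- G) ⟩
    D Q.+ frac 1 3 Q.+ (E Q.- G)                  ≡⟨ cong (D Q.+ frac 1 3 Q.+_) (summand-sum (m ∸ 2)) ⟨
    D Q.+ frac 1 3 Q.+ sumFrom1 (m ∸ 2) summand   ∎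
    where
    open ≡-Reasoning
    split : frac (m + 1) 5 ≡ frac 2 5 Q.+ E
    split = trans (cong (λ j → frac j 5) (+-comm m 1)) (frac-distrib 2 (m ∸ 1) 5)
    regroup : ∀ h e b c g → (h Q.+ e Q.+ b) Q.- c ≡ (h Q.+ b Q.+ g) Q.+ (e Q.- g) Q.- c
    regroup = solveℚ 5 (λ h e b c g → (h :+ e :+ b) :- c := (h :+ b :+ g) :+ (e :- g) :- c) refl
    cancel : ∀ x c s → (x Q.+ c) Q.+ s Q.- c ≡ x Q.+ s
    cancel = solveℚ 3 (λ x c s → (x :+ c) :+ s :- c := x :+ s) refl

-- At m = n + 4 the two sides are literally those of AtIndex.identity n.
lemma4p4 : (m : ℕ) → m > 3 →
    (frac (m + 1) 5 Q.+ frac (4 * F (m + 1)) (5 * L (m + 1)))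
      Q.- frac (F (m ∸ 3) * (F (m + 2) + F (m ∸ 2))) (F (2 * m + 2))
    ≡
    frac ((F (2 * m ∸ 2) + 3 * (F (m ∸ 2) * F (m ∸ 2)))
          * (4 * F (2 * m ∸ 2) + 3 * (F (m ∸ 1) * F (m ∸ 1))))
         (3 * F (2 * m ∸ 2) * F (2 * m + 2))
      Q.+ frac 1 3
      Q.+ sumFrom1 (m ∸ 2) (λ i → frac (F i * F (i + 1)) (L i * L (i + 1)))
lemma4p4 (suc (suc (suc (suc n)))) (s≤s (s≤s (s≤s (s≤s _)))) = AtIndex.identity n
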